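{- Let $\Gamma$ be a finite simple graph and $\sigma\in SEP(\Gamma)$. Then every disjoint cycle in the cycle decomposition of $\sigma$ belongs to $SEP(\Gamma)$, and for every cycle $c$ of $\sigma$, every cycle $\tau$ whose support is a proper subset of the support of $c$ (a proper sub-cycle of $c$; e.g. for $c=(1\,2\,3)$ these include $(1\,2),(1\,3),(2\,3)$) belongs to $SEP(\Gamma)$.
   Context: Two vertices $u,v$ of a graph $\Gamma$ are structurally equivalent if the transposition $(u\,v)$ (swapping $u,v$ and fixing all other vertices) is an automorphism of $\Gamma$. The structural equivalence permutation group is $SEP(\Gamma)=\langle\{(u\,v) : (u\,v)\in \mathrm{Aut}(\Gamma)\}\rangle$, a group of permutations of $V(\Gamma)$. -}

module Defs where

open import Data.Nat using (ℕ; zero; suc)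
open import Data.Bool using (Bool; false)
open import Data.Fin using (Fin)
open import Data.Product using (Σ; _×_; ∃; ∃-syntax; _,_)
open import Relation.Nullary using (¬_)
open import Relation.Binary.PropositionalEquality using (_≡_; _≢_)
open import Data.Fin.Permutation public
  using (Permutation′; _⟨$⟩ʳ_; _⟨$⟩ˡ_; _∘ₚ_; flip; transpose)
  renaming (id to idₚ; _≈_ to _≈ₚ_)

record SimpleGraph (n : ℕ) : Set where
  field
    Adj   : Fin n → Fin n → Bool
    sym   : ∀ x y → Adj x y ≡ Adj y x
    loopless : ∀ x → Adj x x ≡ false
open SimpleGraph public

IsAut : ∀ {n} → SimpleGraph n → Permutation′ n → Set
IsAut Γ π = ∀ x y → Adj Γ (π ⟨$⟩ʳ x) (π ⟨$⟩ʳ y) ≡ Adj Γ x y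

StructEquiv : ∀ {n} → SimpleGraph n → Fin n → Fin n → Set
StructEquiv Γ u v = IsAut Γ (transpose u v)

data InSEP {n : ℕ} (Γ : SimpleGraph n) : Permutation′ n → Set where
  gen  : ∀ u v → u ≢ v → StructEquiv Γ u v → InSEP Γ (transpose u v)
  one  : InSEP Γ idₚ
  mul  : ∀ {σ τ} → InSEP Γ σ → InSEP Γ τ → InSEP Γ (σ ∘ₚ τ)
  inv  : ∀ {σ} → InSEP Γ σ → InSEP Γ (flip σ)
  resp : ∀ {σ τ} → σ ≈ₚ τ → InSEP Γ σ → InSEP Γ τ

iter : ∀ {n} → Permutation′ n → ℕ → Fin n → Fin n
iter σ zero    x = x
iter σ (suc k) x = σ ⟨$⟩ʳ (iter σ k x)

InOrbit : ∀ {n} → Permutation′ n → Fin n → Fin n → Set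
InOrbit σ x y = ∃[ k ] iter σ k x ≡ y

InSupp : ∀ {n} → Permutation′ n → Fin n → Set
InSupp σ y = σ ⟨$⟩ʳ y ≢ y

IsCycleOf : ∀ {n} → Permutation′ n → Permutation′ n → Set
IsCycleOf c σ = Σ _ λ x → InSupp σ x ×
  (∀ y → (InOrbit σ x y → c ⟨$⟩ʳ y ≡ σ ⟨$⟩ʳ y)
       × (¬ InOrbit σ x y → c ⟨$⟩ʳ y ≡ y))

IsCycle : ∀ {n} → Permutation′ n → Set
IsCycle τ = Σ _ λ x → InSupp τ x × (∀ y → InSupp τ y → InOrbit τ x y)

SuppProperSubset : ∀ {n} → Permutation′ n → Permutation′ n → Set
SuppProperSubset τ c =
  (∀ y → InSupp τ y → InSupp c y) × (∃[ y ] InSupp c y × ¬ InSupp τ y)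

{-# OPTIONS --safe #-}
-- Call u and v twins when they have the same neighbours outside {u, v}.
-- Twinship is an equivalence relation, and it holds exactly when the
-- transposition (u v) is an automorphism. Hence SEP(Γ) is precisely the
-- group of permutations sending every vertex to a twin of itself: the
-- generators have this property and it is closed under the group operations;
-- conversely such a σ equals (x σx) ∘ σ′ where σ′ = (x σx) ∘ σ fixes x and
-- every point σ fixes, so induction on the largest moved point applies.
-- A cycle of σ agrees at each point with σ or with the identity, and all
-- points of a σ-orbit are twins, so every permutation supported in a cycle
-- of σ belongs to SEP(Γ).
module Submission where

open import Defs hiding (sym)
open import Data.Bool.Properties as Bool using ()
open import Data.Nat using (ℕ; zero; suc; _≤_; z≤n; _<?_)
open import Data.Nat.Properties using (≤-<-trans; <⇒≱; <-irrefl; m≤n⇒m<n∨m≡n)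
open import Data.Fin using (Fin; toℕ; fromℕ<; _≟_)
open import Data.Fin.Properties using (toℕ<n; toℕ-fromℕ<; toℕ-injective)
open import Data.Fin.Permutation using (inverseʳ)
import Data.Fin.Permutation.Components as PC
open import Data.Product using (_×_; _,_; proj₁; proj₂)
open import Data.Sum using (_⊎_; inj₁; inj₂)
open import Function.Base using (_∘_)
open import Function.Bundles using (Injection)
open import Function.Properties.Inverse using (↔⇒↣)
open import Relation.Nullary using (¬_; yes; no)
open import Relation.Nullary.Decidable using (dec-true; dec-false; decidable-stable)
open import Relation.Nullary.Negation using (contradiction)
open import Relation.Binary.PropositionalEquality
  using (_≡_; _≢_; refl; sym; trans; cong; cong₂; subst; ≢-sym; module ≡-Reasoning)
open ≡-Reasoning

permute-injective : ∀ {n} (π : Permutation′ n) {x y} → π ⟨$⟩ʳ x ≡ π ⟨$⟩ʳ y → x ≡ y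
permute-injective π = Injection.injective (↔⇒↣ π)

module _ {n : ℕ} (i j : Fin n) where

  transpose-matchˡ : PC.transpose i j i ≡ j
  transpose-matchˡ rewrite dec-true (i ≟ i) refl = refl

  transpose-matchʳ : PC.transpose i j j ≡ i
  transpose-matchʳ with j ≟ i
  ... | yes j≡i = j≡i
  ... | no  _   rewrite dec-true (j ≟ j) refl = refl

  transpose-apart : ∀ {k} → k ≢ i → k ≢ j → PC.transpose i j k ≡ k
  transpose-apart {k} k≢i k≢j rewrite dec-false (k ≟ i) k≢i | dec-false (k ≟ j) k≢j = refl

data TransposeView {n : ℕ} (i j : Fin n) : Fin n → Set where
  at-i  : TransposeView i j i
  at-j  : TransposeView i j j
  apart : ∀ {k} → k ≢ i → k ≢ j → TransposeView i j k

transposeView : ∀ {n} (i j k : Fin n) → TransposeView i j k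
transposeView i j k with k ≟ i | k ≟ j
... | yes refl | _        = at-i
... | no  _    | yes refl = at-j
... | no  k≢i  | no  k≢j  = apart k≢i k≢j

transpose-self : ∀ {n} (i k : Fin n) → PC.transpose i i k ≡ k
transpose-self i k with transposeView i i k
... | at-i          = transpose-matchˡ i i
... | at-j          = transpose-matchˡ i i
... | apart k≢i _   = transpose-apart i i k≢i k≢i

FixesOrAgrees : ∀ {n} → Permutation′ n → Permutation′ n → Set
FixesOrAgrees π σ = ∀ y → π ⟨$⟩ʳ y ≡ y ⊎ π ⟨$⟩ʳ y ≡ σ ⟨$⟩ʳ y

cycleOf⇒fixesOrAgrees : ∀ {n} {c σ : Permutation′ n} → IsCycleOf c σ → FixesOrAgrees c σ
cycleOf⇒fixesOrAgrees {c = c} {σ} (_ , _ , onOrbit) y with c ⟨$⟩ʳ y ≟ y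
... | yes fixed = inj₁ fixed
... | no  moved = inj₂ (decidable-stable (c ⟨$⟩ʳ y ≟ σ ⟨$⟩ʳ y)
                    λ c≢σ → moved (proj₂ (onOrbit y) (c≢σ ∘ proj₁ (onOrbit y))))

FixesFrom : ∀ {n} → ℕ → Permutation′ n → Set
FixesFrom m σ = ∀ y → m ≤ toℕ y → σ ⟨$⟩ʳ y ≡ y

module _ {n : ℕ} (σ : Permutation′ n) (x : Fin n) where

  -- π ∘ₚ ρ applies π first.
  fixing : Permutation′ n
  fixing = σ ∘ₚ transpose x (σ ⟨$⟩ʳ x)

  fixing-fixesFrom : ∀ {m} → toℕ x ≡ m → FixesFrom (suc m) σ → FixesFrom m fixing
  fixing-fixesFrom {m} x≡m fix y m≤y with m≤n⇒m<n∨m≡n m≤y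
  ... | inj₂ m≡y with toℕ-injective (trans x≡m m≡y)
  ...   | refl = transpose-matchʳ x (σ ⟨$⟩ʳ x)
  fixing-fixesFrom {m} x≡m fix y m≤y | inj₁ m<y =
    trans (cong (PC.transpose x (σ ⟨$⟩ʳ x)) (fix y m<y))
          (transpose-apart x (σ ⟨$⟩ʳ x) y≢x y≢σx)
    where
    y≢x : y ≢ x
    y≢x y≡x = <-irrefl (sym (trans (cong toℕ y≡x) x≡m)) m<y
    y≢σx : y ≢ σ ⟨$⟩ʳ x
    y≢σx y≡σx = y≢x (permute-injective σ (trans (fix y m<y) y≡σx))

  fixing-∘ₚ-transpose : fixing ∘ₚ transpose (σ ⟨$⟩ʳ x) x ≈ₚ σ
  fixing-∘ₚ-transpose y = PC.transpose-inverse (σ ⟨$⟩ʳ x) x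

module _ {n : ℕ} (Γ : SimpleGraph n) where

  open SimpleGraph Γ using () renaming (sym to Adj-sym; loopless to Adj-loopless)

  Twins : Fin n → Fin n → Set
  Twins u v = ∀ w → w ≢ u → w ≢ v → Adj Γ u w ≡ Adj Γ v w

  twins-refl : ∀ u → Twins u u
  twins-refl u w _ _ = refl

  twins-sym : ∀ {u v} → Twins u v → Twins v u
  twins-sym uv w w≢v w≢u = sym (uv w w≢u w≢v)

  twins-trans : ∀ {u v w} → Twins u v → Twins v w → Twins u w
  twins-trans {u} {v} {w} uv vw x x≢u x≢w with x ≟ v
  ... | no x≢v = trans (uv x x≢u x≢v) (vw x x≢v x≢w)
  ... | yes refl with u ≟ w
  ...   | yes refl = refl
  ...   | no u≢w = begin
    Adj Γ u x  ≡⟨ Adj-sym u x ⟩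
    Adj Γ x u  ≡⟨ vw u (≢-sym x≢u) u≢w ⟩
    Adj Γ w u  ≡⟨ Adj-sym w u ⟩
    Adj Γ u w  ≡⟨ uv w (≢-sym u≢w) (≢-sym x≢w) ⟩
    Adj Γ x w  ≡⟨ Adj-sym x w ⟩
    Adj Γ w x  ∎

  twins-stable : ∀ {u v} → ¬ ¬ Twins u v → Twins u v
  twins-stable {u} {v} ¬¬uv w w≢u w≢v =
    decidable-stable (Adj Γ u w Bool.≟ Adj Γ v w) (λ ne → ¬¬uv (λ uv → ne (uv w w≢u w≢v)))

  structEquiv⇒twins : ∀ {u v} → StructEquiv Γ u v → Twins u v
  structEquiv⇒twins {u} {v} aut w w≢u w≢v = begin
    Adj Γ u w                                        ≡⟨ aut u w ⟨
    Adj Γ (PC.transpose u v u) (PC.transpose u v w)  ≡⟨ cong₂ (Adj Γ) (transpose-matchˡ u v)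
                                                                      (transpose-apart u v w≢u w≢v) ⟩
    Adj Γ v w                                        ∎

  twins⇒structEquiv : ∀ {u v} → Twins u v → StructEquiv Γ u v
  twins⇒structEquiv {u} {v} uv a b with transposeView u v a | transposeView u v b
  ... | at-i | at-i rewrite transpose-matchˡ u v = trans (Adj-loopless v) (sym (Adj-loopless u))
  ... | at-i | at-j rewrite transpose-matchˡ u v | transpose-matchʳ u v = Adj-sym v u
  ... | at-i | apart b≢u b≢v rewrite transpose-matchˡ u v | transpose-apart u v b≢u b≢v =
    sym (uv b b≢u b≢v)
  ... | at-j | at-i rewrite transpose-matchˡ u v | transpose-matchʳ u v = Adj-sym u v
  ... | at-j | at-j rewrite transpose-matchʳ u v = trans (Adj-loopless u) (sym (Adj-loopless v))
  ... | at-j | apart b≢u b≢v rewrite transpose-matchʳ u v | transpose-apart u v b≢u b≢v =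
    uv b b≢u b≢v
  ... | apart a≢u a≢v | at-i rewrite transpose-matchˡ u v | transpose-apart u v a≢u a≢v =
    trans (Adj-sym a v) (trans (sym (uv a a≢u a≢v)) (Adj-sym u a))
  ... | apart a≢u a≢v | at-j rewrite transpose-matchʳ u v | transpose-apart u v a≢u a≢v =
    trans (Adj-sym a u) (trans (uv a a≢u a≢v) (Adj-sym v a))
  ... | apart a≢u a≢v | apart b≢u b≢v
    rewrite transpose-apart u v a≢u a≢v | transpose-apart u v b≢u b≢v = refl

  twins⇒inSEP-transpose : ∀ {u v} → Twins u v → InSEP Γ (transpose u v)
  twins⇒inSEP-transpose {u} {v} uv with u ≟ v
  ... | yes refl = resp (λ k → sym (transpose-self u k)) one
  ... | no u≢v   = gen u v u≢v (twins⇒structEquiv uv)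

  PreservesTwinClasses : Permutation′ n → Set
  PreservesTwinClasses σ = ∀ x → Twins (σ ⟨$⟩ʳ x) x

  transpose-preservesTwinClasses : ∀ {u v} → Twins u v → PreservesTwinClasses (transpose u v)
  transpose-preservesTwinClasses {u} {v} uv k with transposeView u v k
  ... | at-i rewrite transpose-matchˡ u v = twins-sym uv
  ... | at-j rewrite transpose-matchʳ u v = uv
  ... | apart k≢u k≢v rewrite transpose-apart u v k≢u k≢v = twins-refl k

  ∘ₚ-preservesTwinClasses : ∀ {σ τ} → PreservesTwinClasses σ → PreservesTwinClasses τ →
                            PreservesTwinClasses (σ ∘ₚ τ)
  ∘ₚ-preservesTwinClasses {σ} pσ pτ x = twins-trans (pτ (σ ⟨$⟩ʳ x)) (pσ x)

  flip-preservesTwinClasses : ∀ {σ} → PreservesTwinClasses σ → PreservesTwinClasses (flip σ)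
  flip-preservesTwinClasses {σ} pσ x =
    twins-sym (subst (λ z → Twins z (σ ⟨$⟩ˡ x)) (inverseʳ σ) (pσ (σ ⟨$⟩ˡ x)))

  inSEP⇒preservesTwinClasses : ∀ {σ} → InSEP Γ σ → PreservesTwinClasses σ
  inSEP⇒preservesTwinClasses (gen u v _ aut) =
    transpose-preservesTwinClasses (structEquiv⇒twins aut)
  inSEP⇒preservesTwinClasses one             = twins-refl
  inSEP⇒preservesTwinClasses (mul {σ} {τ} p q) =
    ∘ₚ-preservesTwinClasses {σ} {τ} (inSEP⇒preservesTwinClasses p) (inSEP⇒preservesTwinClasses q)
  inSEP⇒preservesTwinClasses (inv {σ} p)     =
    flip-preservesTwinClasses {σ} (inSEP⇒preservesTwinClasses p)
  inSEP⇒preservesTwinClasses (resp σ≈τ p) x  =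
    subst (λ z → Twins z x) (σ≈τ x) (inSEP⇒preservesTwinClasses p x)

  fixesFrom⇒inSEP : ∀ m {σ} → PreservesTwinClasses σ → FixesFrom m σ → InSEP Γ σ
  fixesFrom⇒inSEP zero    pσ fix = resp (λ y → sym (fix y z≤n)) one
  fixesFrom⇒inSEP (suc m) pσ fix with m <? n
  ... | no m≮n = fixesFrom⇒inSEP m pσ (λ y m≤y → contradiction (≤-<-trans m≤y (toℕ<n y)) m≮n)
  fixesFrom⇒inSEP (suc m) {σ} pσ fix | yes m<n =
    resp (fixing-∘ₚ-transpose σ x) (mul fixing∈SEP (twins⇒inSEP-transpose (pσ x)))
    where
    x : Fin n
    x = fromℕ< m<n
    fixing∈SEP : InSEP Γ (fixing σ x)
    fixing∈SEP = fixesFrom⇒inSEP m {fixing σ x}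
      (∘ₚ-preservesTwinClasses {σ} {transpose x (σ ⟨$⟩ʳ x)} pσ
        (transpose-preservesTwinClasses (twins-sym (pσ x))))
      (fixing-fixesFrom σ x (toℕ-fromℕ< m<n) fix)

  preservesTwinClasses⇒inSEP : ∀ σ → PreservesTwinClasses σ → InSEP Γ σ
  preservesTwinClasses⇒inSEP σ pσ =
    fixesFrom⇒inSEP n pσ (λ y n≤y → contradiction n≤y (<⇒≱ (toℕ<n y)))

  iter-twins : ∀ {σ} → InSEP Γ σ → ∀ k x → Twins (iter σ k x) x
  iter-twins σ∈SEP zero    x = twins-refl x
  iter-twins σ∈SEP (suc k) x =
    twins-trans (inSEP⇒preservesTwinClasses σ∈SEP _) (iter-twins σ∈SEP k x)

  fixesOrAgrees-preservesTwinClasses :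
    ∀ {π σ} → FixesOrAgrees π σ → PreservesTwinClasses σ → PreservesTwinClasses π
  fixesOrAgrees-preservesTwinClasses agree pσ y with agree y
  ... | inj₁ fixed = subst (λ z → Twins z y) (sym fixed) (twins-refl y)
  ... | inj₂ same  = subst (λ z → Twins z y) (sym same) (pσ y)

  supportedInTwinClass⇒preservesTwinClasses :
    ∀ {τ x} → (∀ y → InSupp τ y → Twins y x) → PreservesTwinClasses τ
  supportedInTwinClass⇒preservesTwinClasses {τ} supp⊆ y with τ ⟨$⟩ʳ y ≟ y
  ... | yes fixed = subst (λ z → Twins z y) (sym fixed) (twins-refl y)
  ... | no  moved =
    twins-trans (supp⊆ (τ ⟨$⟩ʳ y) (moved ∘ permute-injective τ)) (twins-sym (supp⊆ y moved))

  cycleOf-supp⊆twinClass : ∀ {σ c} → InSEP Γ σ → (cyc : IsCycleOf c σ) →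
                           ∀ y → InSupp c y → Twins y (proj₁ cyc)
  cycleOf-supp⊆twinClass σ∈SEP (x , _ , onOrbit) y moved = twins-stable λ ¬twins →
    moved (proj₂ (onOrbit y) λ { (k , iterₖx≡y) →
      ¬twins (subst (λ z → Twins z x) iterₖx≡y (iter-twins σ∈SEP k x)) })

theorem2p4 : ∀ {n : ℕ} (Γ : SimpleGraph n) (σ : Permutation′ n) →
    InSEP Γ σ →
    (∀ c → IsCycleOf c σ → InSEP Γ c)
    × (∀ c τ → IsCycleOf c σ → IsCycle τ → SuppProperSubset τ c → InSEP Γ τ)
theorem2p4 Γ σ σ∈SEP = cycle∈SEP , subcycle∈SEP
  where
  cycle∈SEP : ∀ c → IsCycleOf c σ → InSEP Γ c
  cycle∈SEP c cyc = preservesTwinClasses⇒inSEP Γ c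
    (fixesOrAgrees-preservesTwinClasses Γ {c} {σ} (cycleOf⇒fixesOrAgrees {c = c} {σ} cyc)
      (inSEP⇒preservesTwinClasses Γ σ∈SEP))

  subcycle∈SEP : ∀ c τ → IsCycleOf c σ → IsCycle τ → SuppProperSubset τ c → InSEP Γ τ
  subcycle∈SEP c τ cyc _ (supp⊆ , _) = preservesTwinClasses⇒inSEP Γ τ
    (supportedInTwinClass⇒preservesTwinClasses Γ {τ}
      (λ y moved → cycleOf-supp⊆twinClass Γ {σ} {c} σ∈SEP cyc y (supp⊆ y moved)))
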